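{- Let $r<w$ be positive reals. There is an optimal (strictly $1$-competitive) deterministic online algorithm with $1$ advice bit for the $(n,k,r,w)$-Parity for Number of Hats problem.
   Context: A deterministic online algorithm with advice computes $y_i$ from an advice string $\phi$ and $x_1,\dots,x_i$, where $\phi$ is chosen by an Adviser who knows the whole input; it is $c$-competitive with advice complexity $b$ if there is $\alpha\ge 0$ such that for every input $I$ there is $\phi$ of at most $b$ bits with $cost\le c\cdot cost(Opt(I))+\alpha$ ($Opt$ an optimal offline algorithm); it is optimal if this holds with $c=1$, $\alpha=0$. For $X\in\{0,1\}^m$ with $\#_1(X)=v\cdot 2^k$, $v$ an integer, $PartialMOD_m^k(X)=v\bmod 2$. The $(n,k,r,w)$-Parity for Number of Hats problem: feasible inputs are $I=(2,X_1,2,X_2,2,X_3)$ of length $n=m_1+m_2+m_3+3$, with $m_i\ge 2^{k+1}$, $X_i\in\{0,1\}^{m_i}$, $\#_1(X_i)$ a multiple of $2^k$. Let $y_1,y_2,y_3$ be the output bits at the three requests with value $2$ and $z_j=\bigoplus_{i=j}^{3}PartialMOD_{m_i}^k(X_i)$. The cost is $r$ if $y_j=z_j$ for all $j$, and $w$ otherwise, with $r<w$.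
   Formalization: The costs r and w are rational numbers with $r<w$ rather than arbitrary positive reals. -}

module Defs where

open import Data.Bool using (Bool; true; false; not; _xor_; if_then_else_)
open import Data.Nat using (ℕ; zero; suc; _+_; _*_; _^_; _≤_; _/_; _%_; _≡ᵇ_)
open import Data.Nat.Properties using (m^n≢0)
open import Data.Nat.Divisibility using (_∣_)
open import Data.List using (List; []; _∷_; _++_; length; map; drop)
open import Data.Product using (_×_)
open import Data.Rational using (ℚ)
open import Relation.Binary.PropositionalEquality using (_≡_)

-- Requests are natural numbers (the problem uses the values 0, 1 and 2).
Request : Set
Request = ℕ

-- A deterministic online algorithm with advice: the output y_i (a bit)
-- is computed from the advice string φ and the prefix x_1,…,x_i.
OnlineAlg : Set
OnlineAlg = List Bool → List Request → Bool

runFrom : OnlineAlg → List Bool → List Request → List Request → List Bool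
runFrom A φ seen []       = []
runFrom A φ seen (x ∷ xs) = A φ (seen ++ (x ∷ [])) ∷ runFrom A φ (seen ++ (x ∷ [])) xs

run : OnlineAlg → List Bool → List Request → List Bool
run A φ I = runFrom A φ [] I

ones : List Bool → ℕ
ones []          = 0
ones (true ∷ X)  = suc (ones X)
ones (false ∷ X) = ones X

partialMOD : ℕ → List Bool → Bool
partialMOD k X = ((ones X / (2 ^ k)) {{m^n≢0 2 k}} % 2) ≡ᵇ 1

bitReq : Bool → Request
bitReq true  = 1
bitReq false = 0

hatsInput : List Bool → List Bool → List Bool → List Request
hatsInput X₁ X₂ X₃ =
  2 ∷ (map bitReq X₁ ++ (2 ∷ (map bitReq X₂ ++ (2 ∷ map bitReq X₃))))

Feasible : ℕ → ℕ → List Bool → List Bool → List Bool → Set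
Feasible n k X₁ X₂ X₃ =
  (n ≡ length X₁ + length X₂ + length X₃ + 3)
  × (2 ^ suc k ≤ length X₁) × (2 ^ suc k ≤ length X₂) × (2 ^ suc k ≤ length X₃)
  × (2 ^ k ∣ ones X₁) × (2 ^ k ∣ ones X₂) × (2 ^ k ∣ ones X₃)

-- is the output at (0-based) position p equal to the bit z?
outputIs : List Bool → ℕ → Bool → Bool
outputIs ys p z with drop p ys
... | []     = false
... | b ∷ _  = not (b xor z)

allCorrect : ℕ → List Bool → List Bool → List Bool → List Bool → Bool
allCorrect k X₁ X₂ X₃ ys =
  let p₁ = partialMOD k X₁
      p₂ = partialMOD k X₂
      p₃ = partialMOD k X₃
      z₁ = p₁ xor (p₂ xor p₃)
      z₂ = p₂ xor p₃
      z₃ = p₃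
  in  if outputIs ys 0 z₁
      then (if outputIs ys (1 + length X₁) z₂
            then outputIs ys (2 + length X₁ + length X₂) z₃
            else false)
      else false

hatsCost : ℚ → ℚ → ℕ → List Bool → List Bool → List Bool → List Bool → ℚ
hatsCost r w k X₁ X₂ X₃ ys = if allCorrect k X₁ X₂ X₃ ys then r else w

module Submission where

-- Write pⱼ = PartialMOD(Xⱼ).  The targets satisfy z₃ = p₃, z₂ = p₂ ⊕ z₃ and
-- z₁ = p₁ ⊕ z₂, hence z₂ = z₁ ⊕ p₁ and z₃ = z₂ ⊕ p₂.  The adviser writes the
-- single bit z₁.  The algorithm keeps an accumulator, initialised to the advice
-- bit, and a counter of ones in the current block; at every request 2 it xors
-- PartialMOD of the finished block into the accumulator and outputs it.  So at
-- the j-th request 2 it outputs z₁ ⊕ p₁ ⊕ … ⊕ pⱼ₋₁ = zⱼ, all outputs are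
-- correct, the cost is r, and r ≤ w makes this optimal.

open import Defs
open import Data.Bool using (Bool; true; false; _xor_; not; if_then_else_)
open import Data.Bool.Properties using (xor-same; xor-identityʳ)
open import Data.Nat using (ℕ; suc; _+_; _/_; _%_; _^_; _≡ᵇ_; s≤s; z≤n)
import Data.Nat as N
open import Data.Nat.Properties using (+-suc; +-identityʳ; m^n≢0)
open import Data.List using (List; length; []; _∷_; _++_; drop; map)
open import Data.List.Properties using (length-map; length-++; ++-assoc; ++-identityʳ)
open import Data.Product using (Σ; _×_; _,_)
open import Data.Rational using (ℚ; 0ℚ; _<_; _≤_)
open import Data.Rational.Properties using (≤-refl; <⇒≤)
open import Relation.Binary.PropositionalEquality
  using (_≡_; refl; sym; trans; cong; cong₂; module ≡-Reasoning)
open ≡-Reasoning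

-- PartialMOD as a function of the number of ones; partialMOD k X is
-- definitionally blockParity k (ones X).
blockParity : ℕ → ℕ → Bool
blockParity k c = ((c / (2 ^ k)) {{m^n≢0 2 k}} % 2) ≡ᵇ 1

-- The algorithm's state machine: 'scan k acc c xs' processes the requests xs
-- with accumulator acc and c ones seen in the current block, and returns the
-- accumulator.
scan : ℕ → Bool → ℕ → List Request → Bool
scan k acc c []                      = acc
scan k acc c (0 ∷ xs)                = scan k acc c xs
scan k acc c (1 ∷ xs)                = scan k acc (suc c) xs
scan k acc c (2 ∷ xs)                = scan k (acc xor blockParity k c) 0 xs
scan k acc c (suc (suc (suc _)) ∷ xs) = scan k acc c xs

scan-block : ∀ k acc c X rest →
  scan k acc c (map bitReq X ++ rest) ≡ scan k acc (c + ones X) rest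
scan-block k acc c []          rest rewrite +-identityʳ c = refl
scan-block k acc c (true ∷ X)  rest rewrite +-suc c (ones X) = scan-block k acc (suc c) X rest
scan-block k acc c (false ∷ X) rest = scan-block k acc c X rest

-- The advice bit (absent advice is read as false).
adviceBit : List Bool → Bool
adviceBit []      = false
adviceBit (b ∷ _) = b

hatsAlg : ℕ → OnlineAlg
hatsAlg k φ []      = false
hatsAlg k φ (_ ∷ s) = scan k (adviceBit φ) 0 s

runFrom-drop : ∀ A φ s xs ys →
  drop (length xs) (runFrom A φ s (xs ++ ys)) ≡ runFrom A φ (s ++ xs) ys
runFrom-drop A φ s []       ys rewrite ++-identityʳ s = refl
runFrom-drop A φ s (x ∷ xs) ys
  rewrite runFrom-drop A φ (s ++ x ∷ []) xs ys | ++-assoc s (x ∷ []) xs = refl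

output-correct : ∀ A φ {I p z} xs x ys →
  I ≡ xs ++ x ∷ ys → p ≡ length xs → A φ (xs ++ x ∷ []) ≡ z →
  outputIs (run A φ I) p z ≡ true
output-correct A φ xs x ys refl refl refl
  rewrite runFrom-drop A φ [] xs (x ∷ ys) = cong not (xor-same (A φ (xs ++ x ∷ [])))

xor-cancel : ∀ p q → (p xor q) xor p ≡ q
xor-cancel true  true  = refl
xor-cancel true  false = refl
xor-cancel false q     = xor-identityʳ q

allCorrect-intro : ∀ k X₁ X₂ X₃ ys →
  let p₁ = partialMOD k X₁ ; p₂ = partialMOD k X₂ ; p₃ = partialMOD k X₃ in
  outputIs ys 0 (p₁ xor (p₂ xor p₃)) ≡ true →
  outputIs ys (1 + length X₁) (p₂ xor p₃) ≡ true →
  outputIs ys (2 + length X₁ + length X₂) p₃ ≡ true →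
  allCorrect k X₁ X₂ X₃ ys ≡ true
allCorrect-intro k X₁ X₂ X₃ ys c₁ c₂ c₃ rewrite c₁ | c₂ | c₃ = refl

hatsAlg-correct : ∀ k X₁ X₂ X₃ →
  let z₁ = partialMOD k X₁ xor (partialMOD k X₂ xor partialMOD k X₃) in
  allCorrect k X₁ X₂ X₃ (run (hatsAlg k) (z₁ ∷ []) (hatsInput X₁ X₂ X₃)) ≡ true
hatsAlg-correct k X₁ X₂ X₃ =
  allCorrect-intro k X₁ X₂ X₃ (run A φ (hatsInput X₁ X₂ X₃))
    (output-correct A φ [] 2 (M₁ ++ 2 ∷ M₂ ++ 2 ∷ M₃) refl refl refl)
    (output-correct A φ (2 ∷ M₁) 2 (M₂ ++ 2 ∷ M₃) refl (cong suc (sym (length-map bitReq X₁))) second)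
    (output-correct A φ pre₃ 2 M₃ input₃ position₃ third)
  where
  p₁ = partialMOD k X₁
  p₂ = partialMOD k X₂
  p₃ = partialMOD k X₃
  A = hatsAlg k
  φ = (p₁ xor (p₂ xor p₃)) ∷ []
  M₁ = map bitReq X₁
  M₂ = map bitReq X₂
  M₃ = map bitReq X₃
  pre₃ = (2 ∷ M₁) ++ 2 ∷ M₂

  second : scan k (p₁ xor (p₂ xor p₃)) 0 (M₁ ++ 2 ∷ []) ≡ p₂ xor p₃
  second = trans (scan-block k _ 0 X₁ (2 ∷ [])) (xor-cancel p₁ (p₂ xor p₃))

  third : scan k (p₁ xor (p₂ xor p₃)) 0 ((M₁ ++ 2 ∷ M₂) ++ 2 ∷ []) ≡ p₃
  third = begin
    scan k (p₁ xor (p₂ xor p₃)) 0 ((M₁ ++ 2 ∷ M₂) ++ 2 ∷ [])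
      ≡⟨ cong (scan k _ 0) (++-assoc M₁ (2 ∷ M₂) (2 ∷ [])) ⟩
    scan k (p₁ xor (p₂ xor p₃)) 0 (M₁ ++ 2 ∷ M₂ ++ 2 ∷ [])
      ≡⟨ scan-block k _ 0 X₁ _ ⟩
    scan k ((p₁ xor (p₂ xor p₃)) xor p₁) 0 (M₂ ++ 2 ∷ [])
      ≡⟨ cong (λ a → scan k a 0 (M₂ ++ 2 ∷ [])) (xor-cancel p₁ (p₂ xor p₃)) ⟩
    scan k (p₂ xor p₃) 0 (M₂ ++ 2 ∷ [])
      ≡⟨ scan-block k _ 0 X₂ _ ⟩
    (p₂ xor p₃) xor p₂
      ≡⟨ xor-cancel p₂ p₃ ⟩
    p₃ ∎

  input₃ : hatsInput X₁ X₂ X₃ ≡ pre₃ ++ 2 ∷ M₃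
  input₃ = cong (2 ∷_) (sym (++-assoc M₁ (2 ∷ M₂) (2 ∷ M₃)))

  position₃ : 2 + length X₁ + length X₂ ≡ length pre₃
  position₃ = cong suc (begin
    suc (length X₁ + length X₂)    ≡⟨ sym (+-suc (length X₁) (length X₂)) ⟩
    length X₁ + suc (length X₂)    ≡⟨ cong₂ (λ a b → a + suc b) (sym (length-map bitReq X₁))
                                                                 (sym (length-map bitReq X₂)) ⟩
    length M₁ + length (2 ∷ M₂)    ≡⟨ sym (length-++ M₁) ⟩
    length (M₁ ++ 2 ∷ M₂)          ∎)

correct-is-cheapest : ∀ {r w} → r < w → ∀ b → r ≤ (if b then r else w)
correct-is-cheapest r<w true  = ≤-refl
correct-is-cheapest r<w false = <⇒≤ r<w

theorem11 : (n k : ℕ) (r w : ℚ) → 0ℚ < r → r < w →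
    Σ OnlineAlg λ A →
    (X₁ X₂ X₃ : List Bool) → Feasible n k X₁ X₂ X₃ →
    Σ (List Bool) λ φ →
    (length φ N.≤ 1)
    × ((ys : List Bool) → length ys ≡ length (hatsInput X₁ X₂ X₃) →
    hatsCost r w k X₁ X₂ X₃ (run A φ (hatsInput X₁ X₂ X₃))
    ≤ hatsCost r w k X₁ X₂ X₃ ys)
theorem11 n k r w _ r<w = hatsAlg k , λ X₁ X₂ X₃ _ →
  (partialMOD k X₁ xor (partialMOD k X₂ xor partialMOD k X₃)) ∷ [] ,
  s≤s z≤n ,
  λ ys _ → optimal X₁ X₂ X₃ ys
  where
  optimal : ∀ X₁ X₂ X₃ ys →
    hatsCost r w k X₁ X₂ X₃
      (run (hatsAlg k) ((partialMOD k X₁ xor (partialMOD k X₂ xor partialMOD k X₃)) ∷ [])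
           (hatsInput X₁ X₂ X₃))
    ≤ hatsCost r w k X₁ X₂ X₃ ys
  optimal X₁ X₂ X₃ ys rewrite hatsAlg-correct k X₁ X₂ X₃ =
    correct-is-cheapest r<w (allCorrect k X₁ X₂ X₃ ys)
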